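{- Let $N,k\in\mathbb{N}$, let $m_1,\ldots,m_d\in\mathbb{N}$ be pairwise coprime, and let $m:=m_1\cdots m_d$. If $\gcd(Nk,m)=1$, then $\mathcal{L}_{N,m,k}$ is the unique subset of $\mathbb{Z}/m\mathbb{Z}$ determined by the sets $\mathcal{L}_{N,m_i,k}$ via the Chinese Remainder Theorem; that is, the map $x\mapsto(x\bmod m_1,\ldots,x\bmod m_d)$ is a bijection from $\mathcal{L}_{N,m,k}$ onto $\prod_{i=1}^d\mathcal{L}_{N,m_i,k}$, so that \[ \mathcal{L}_{N,m,k}=\{x\in\mathbb{Z}/m\mathbb{Z}: x\bmod m_i\in\mathcal{L}_{N,m_i,k}\text{ for all } 1\le i\le d\}. \]
   Context: $\mathcal{H}_{N,m}:=\{(x,y)\in(\mathbb{Z}/m\mathbb{Z})^2: xy\equiv N \bmod m\}$ and, for $\gcd(Nk,m)=1$, $\mathcal{L}_{N,m,k}:=\{kx+y\bmod m:(x,y)\in\mathcal{H}_{N,m}\}$. -}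

module Defs where

open import Data.Nat using (ℕ; _+_; _*_; _<_; NonZero)
open import Data.Nat.DivMod using (_%_)
open import Data.Nat.Coprimality using (Coprime)
open import Data.Fin using (Fin; toℕ)
open import Data.List using (List; foldr)
open import Data.Product using (Σ; ∃; _×_; _,_)
open import Relation.Binary.PropositionalEquality using (_≡_)

-- ℤ/mℤ is modelled by the residues {0,…,m-1}, i.e. by Fin m (m ≥ 1).

InH : (N m : ℕ) → .{{_ : NonZero m}} → Fin m → Fin m → Set
InH N m x y = (toℕ x * toℕ y) % m ≡ N % m

InL : (N m k : ℕ) → .{{_ : NonZero m}} → Fin m → Set
InL N m k z = Σ (Fin m) λ x → Σ (Fin m) λ y →
  InH N m x y × (k * toℕ x + toℕ y) % m ≡ toℕ z

prodF : (d : ℕ) → (Fin d → ℕ) → ℕ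
prodF d ms = Data.Vec.Functional.foldr _*_ 1 ms
  where import Data.Vec.Functional

reduce : {m : ℕ} (m' : ℕ) → .{{_ : NonZero m'}} → Fin m → Fin m'
reduce m' x = Data.Fin.fromℕ< (Data.Nat.DivMod.m%n<n (toℕ x) m')
  where import Data.Fin
        import Data.Nat.DivMod

{-# OPTIONS --safe #-}
-- Reduction modulo m_i sends H_{N,m} into H_{N,m_i} and hence L_{N,m,k} into
-- L_{N,m_i,k}. Since the m_i are pairwise coprime, the Chinese Remainder Theorem
-- makes ℤ/mℤ → ∏ ℤ/m_iℤ injective, and lifting points (x_i, y_i) ∈ H_{N,m_i}
-- coordinatewise by CRT gives a point (x, y) ∈ H_{N,m}, because x y ≡ N holds
-- modulo every m_i and therefore modulo m; then k x + y reduces to k x_i + y_i.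
module Submission where

open import Defs
open import Data.Nat using (ℕ; zero; suc; _*_; _+_; _∸_; _≤_; NonZero)
open import Data.Nat.Properties
open import Data.Nat.DivMod
open import Data.Nat.Divisibility
open import Data.Nat.Coprimality using (Coprime; coprime-divisor; coprime-Bézout)
import Data.Nat.Coprimality as Coprime
open import Data.Nat.GCD using (module Bézout)
open import Data.Nat.Tactic.RingSolver using (solve-∀)
open import Data.Fin using (Fin; zero; suc; toℕ)
open import Data.Fin.Properties using (toℕ-fromℕ<; toℕ-injective; toℕ<n)
  renaming (suc-injective to Fin-suc-injective)
open import Data.Vec.Functional using (tail)
open import Data.Product using (Σ; ∃; ∃₂; _×_; _,_; proj₁; proj₂; map₂; swap)
open import Data.Sum using (inj₁; inj₂)
open import Function using (_∘_)
open import Relation.Binary.PropositionalEquality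

infix 4 _≡_[mod_]
record _≡_[mod_] (a b n : ℕ) .{{_ : NonZero n}} : Set where
  constructor mk-≡-mod
  field %≡% : a % n ≡ b % n
open _≡_[mod_]

module _ {n : ℕ} .{{_ : NonZero n}} where

  ≡-mod-refl : ∀ a → a ≡ a [mod n ]
  ≡-mod-refl a = mk-≡-mod refl

  ≡-mod-sym : ∀ {a b} → a ≡ b [mod n ] → b ≡ a [mod n ]
  ≡-mod-sym (mk-≡-mod a≡b) = mk-≡-mod (sym a≡b)

  ≡-mod-trans : ∀ {a b c} → a ≡ b [mod n ] → b ≡ c [mod n ] → a ≡ c [mod n ]
  ≡-mod-trans (mk-≡-mod a≡b) (mk-≡-mod b≡c) = mk-≡-mod (trans a≡b b≡c)

  +-cong-mod : ∀ {a a′ b b′} → a ≡ a′ [mod n ] → b ≡ b′ [mod n ] → a + b ≡ a′ + b′ [mod n ]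
  +-cong-mod {a} {a′} {b} {b′} (mk-≡-mod a≡a′) (mk-≡-mod b≡b′) = mk-≡-mod (begin
    (a + b) % n               ≡⟨ %-distribˡ-+ a b n ⟩
    (a % n + b % n) % n       ≡⟨ cong₂ (λ u v → (u + v) % n) a≡a′ b≡b′ ⟩
    (a′ % n + b′ % n) % n     ≡⟨ %-distribˡ-+ a′ b′ n ⟨
    (a′ + b′) % n             ∎)
    where open ≡-Reasoning

  *-cong-mod : ∀ {a a′ b b′} → a ≡ a′ [mod n ] → b ≡ b′ [mod n ] → a * b ≡ a′ * b′ [mod n ]
  *-cong-mod {a} {a′} {b} {b′} (mk-≡-mod a≡a′) (mk-≡-mod b≡b′) = mk-≡-mod (begin
    (a * b) % n               ≡⟨ %-distribˡ-* a b n ⟩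
    (a % n * (b % n)) % n     ≡⟨ cong₂ (λ u v → (u * v) % n) a≡a′ b≡b′ ⟩
    (a′ % n * (b′ % n)) % n   ≡⟨ %-distribˡ-* a′ b′ n ⟨
    (a′ * b′) % n             ∎)
    where open ≡-Reasoning

  toℕ-mod : ∀ a → toℕ (a mod n) ≡ a % n
  toℕ-mod a = toℕ-fromℕ< (m%n<n a n)

  toℕ-mod-≡ : ∀ a → toℕ (a mod n) ≡ a [mod n ]
  toℕ-mod-≡ a = mk-≡-mod (trans (cong (_% n) (toℕ-mod a)) (m%n%n≡m%n a n))

  toℕ%n : (z : Fin n) → toℕ z % n ≡ toℕ z
  toℕ%n z = m<n⇒m%n≡m (toℕ<n z)

  ≡-mod⇒mod-≡ : ∀ {a} {z : Fin n} → a ≡ toℕ z [mod n ] → a mod n ≡ z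
  ≡-mod⇒mod-≡ {a} {z} (mk-≡-mod a≡z) = toℕ-injective (trans (toℕ-mod a) (trans a≡z (toℕ%n z)))

  mod-≡⇒≡-mod : ∀ {a b} → a mod n ≡ b mod n → a ≡ b [mod n ]
  mod-≡⇒≡-mod {a} {b} a≡b = mk-≡-mod (trans (sym (toℕ-mod a)) (trans (cong toℕ a≡b) (toℕ-mod b)))

  1+xn≡c⇒c≡1-mod : ∀ x {c} → 1 + x * n ≡ c → c ≡ 1 [mod n ]
  1+xn≡c⇒c≡1-mod x 1+xn≡c = mk-≡-mod (trans (cong (_% n) (sym 1+xn≡c)) ([m+kn]%n≡m%n 1 x n))

  ≡-mod⇒∣∸ : ∀ {a b} → a ≡ b [mod n ] → n ∣ b ∸ a
  ≡-mod⇒∣∸ {a} {b} (mk-≡-mod a≡b) = divides (b / n ∸ a / n) (begin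
    b ∸ a                                    ≡⟨ cong₂ _∸_ (m≡m%n+[m/n]*n b n) (m≡m%n+[m/n]*n a n) ⟩
    (b % n + b / n * n) ∸ (a % n + a / n * n) ≡⟨ cong (λ u → (b % n + b / n * n) ∸ (u + a / n * n)) a≡b ⟩
    (b % n + b / n * n) ∸ (b % n + a / n * n) ≡⟨ [m+n]∸[m+o]≡n∸o (b % n) _ _ ⟩
    b / n * n ∸ a / n * n                    ≡⟨ *-distribʳ-∸ n (b / n) (a / n) ⟨
    (b / n ∸ a / n) * n                      ∎)
    where open ≡-Reasoning

  ∣∸⇒≡-mod : ∀ {a b} → a ≤ b → n ∣ b ∸ a → a ≡ b [mod n ]
  ∣∸⇒≡-mod {a} {b} a≤b (divides q b∸a≡q*n) = mk-≡-mod (begin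
    a % n                ≡⟨ [m+kn]%n≡m%n a q n ⟨
    (a + q * n) % n      ≡⟨ cong (λ u → (a + u) % n) b∸a≡q*n ⟨
    (a + (b ∸ a)) % n    ≡⟨ cong (_% n) (m+[n∸m]≡n a≤b) ⟩
    b % n                ∎)
    where open ≡-Reasoning

≡-mod-∣ : ∀ {m n a b} .{{_ : NonZero m}} .{{_ : NonZero n}} → m ∣ n → a ≡ b [mod n ] → a ≡ b [mod m ]
≡-mod-∣ {m} {n} {a} {b} m∣n (mk-≡-mod a≡b) = mk-≡-mod
  (trans (sym (m∣n⇒o%n%m≡o%m m n a m∣n)) (trans (cong (_% m) a≡b) (m∣n⇒o%n%m≡o%m m n b m∣n)))

coprime-*ʳ : ∀ {a b c} → Coprime a b → Coprime a c → Coprime a (b * c)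
coprime-*ʳ {a} {b} {c} a⊥b a⊥c {i} (i∣a , i∣b*c) = a⊥c (i∣a , coprime-divisor i⊥b i∣b*c)
  where
  i⊥b : Coprime i b
  i⊥b (j∣i , j∣b) = a⊥b (∣-trans j∣i i∣a , j∣b)

coprime⇒*-∣ : ∀ {a b t} → Coprime a b → a ∣ t → b ∣ t → a * b ∣ t
coprime⇒*-∣ {a} {b} a⊥b (divides q refl) b∣q*a =
  subst (a * b ∣_) (*-comm a q) (*-monoʳ-∣ a b∣q)
  where
  b∣q : b ∣ q
  b∣q = coprime-divisor (Coprime.sym a⊥b) (subst (b ∣_) (*-comm q a) b∣q*a)

-- With e ≡ 1 (mod a) and e ≡ 0 (mod b), the solution is s + (r - s) e, written
-- without subtraction by taking r + (a - 1) s for r - s.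
crt-from-idempotent : ∀ {a b e} .{{_ : NonZero a}} .{{_ : NonZero b}} →
  e ≡ 1 [mod a ] → b ∣ e → ∀ r s → ∃ λ X → X ≡ r [mod a ] × X ≡ s [mod b ]
crt-from-idempotent {a@(suc a′)} {b} {e} e≡1 (divides q e≡q*b) r s =
  s + t * e , ≡r , ≡s
  where
  open ≡-Reasoning
  t = r + a′ * s
  rearrange : ∀ r s a′ → s + (r + a′ * s) * 1 ≡ r + s * suc a′
  rearrange = solve-∀
  ≡r : s + t * e ≡ r [mod a ]
  ≡r = ≡-mod-trans (+-cong-mod (≡-mod-refl s) (*-cong-mod (≡-mod-refl t) e≡1)) (mk-≡-mod (begin
    (s + t * 1) % a   ≡⟨ cong (_% a) (rearrange r s a′) ⟩
    (r + s * a) % a   ≡⟨ [m+kn]%n≡m%n r s a ⟩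
    r % a             ∎))
  ≡s : s + t * e ≡ s [mod b ]
  ≡s = mk-≡-mod (begin
    (s + t * e) % b         ≡⟨ cong (λ u → (s + u) % b) (trans (cong (t *_) e≡q*b) (sym (*-assoc t q b))) ⟩
    (s + t * q * b) % b     ≡⟨ [m+kn]%n≡m%n s (t * q) b ⟩
    s % b                   ∎)

crt₂ : ∀ {a b} .{{_ : NonZero a}} .{{_ : NonZero b}} →
  Coprime a b → ∀ r s → ∃ λ X → X ≡ r [mod a ] × X ≡ s [mod b ]
crt₂ {a} {b} a⊥b r s with coprime-Bézout a⊥b
... | Bézout.-+ x y 1+xa≡yb = crt-from-idempotent (1+xn≡c⇒c≡1-mod x 1+xa≡yb) (n∣m*n y) r s
... | Bézout.+- x y 1+yb≡xa = map₂ swap (crt-from-idempotent (1+xn≡c⇒c≡1-mod y 1+yb≡xa) (n∣m*n x) s r)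

Pairwise-coprime : ∀ {d} → (Fin d → ℕ) → Set
Pairwise-coprime ms = ∀ i j → i ≢ j → Coprime (ms i) (ms j)

coprime-prodF : ∀ {a d} (ms : Fin d → ℕ) → (∀ i → Coprime a (ms i)) → Coprime a (prodF d ms)
coprime-prodF {d = zero}  ms a⊥ms (_ , i∣1) = ∣1⇒≡1 i∣1
coprime-prodF {d = suc d} ms a⊥ms = coprime-*ʳ (a⊥ms zero) (coprime-prodF (tail ms) (a⊥ms ∘ suc))

module _ {d : ℕ} {ms : Fin (suc d) → ℕ} (pw : Pairwise-coprime ms) where

  Pairwise-coprime-tail : Pairwise-coprime (tail ms)
  Pairwise-coprime-tail i j i≢j = pw (suc i) (suc j) (i≢j ∘ Fin-suc-injective)

  coprime-head-prodF : Coprime (ms zero) (prodF d (tail ms))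
  coprime-head-prodF = coprime-prodF (tail ms) (λ i → pw zero (suc i) λ ())

∣prodF : ∀ {d} (ms : Fin d → ℕ) i → ms i ∣ prodF d ms
∣prodF ms zero    = m∣m*n _
∣prodF ms (suc i) = ∣n⇒∣m*n (ms zero) (∣prodF (tail ms) i)

prodF-∣ : ∀ {d t} {ms : Fin d → ℕ} → Pairwise-coprime ms → (∀ i → ms i ∣ t) → prodF d ms ∣ t
prodF-∣ {zero}  {t} pw ms∣t = 1∣ t
prodF-∣ {suc d}     pw ms∣t =
  coprime⇒*-∣ (coprime-head-prodF pw) (ms∣t zero) (prodF-∣ (Pairwise-coprime-tail pw) (ms∣t ∘ suc))

prodF-nonZero : ∀ {d} (ms : Fin d → ℕ) {{nz : ∀ {i} → NonZero (ms i)}} → NonZero (prodF d ms)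
prodF-nonZero {zero}  ms = _
prodF-nonZero {suc d} ms {{nz}} = m*n≢0 (ms zero) (prodF d (tail ms)) {{nz}} {{prodF-nonZero (tail ms)}}

≡-mod-prodF : ∀ {d} {ms : Fin d → ℕ} {{nz : ∀ {i} → NonZero (ms i)}} .{{_ : NonZero (prodF d ms)}} →
  Pairwise-coprime ms → ∀ X Y → (∀ i → X ≡ Y [mod ms i ]) → X ≡ Y [mod prodF d ms ]
≡-mod-prodF pw X Y X≡Y with ≤-total X Y
... | inj₁ X≤Y = ∣∸⇒≡-mod X≤Y (prodF-∣ pw (≡-mod⇒∣∸ ∘ X≡Y))
... | inj₂ Y≤X = ≡-mod-sym (∣∸⇒≡-mod Y≤X (prodF-∣ pw (≡-mod⇒∣∸ ∘ ≡-mod-sym ∘ X≡Y)))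

crt : ∀ {d} (ms : Fin d → ℕ) {{nz : ∀ {i} → NonZero (ms i)}} → Pairwise-coprime ms →
  (r : Fin d → ℕ) → ∃ λ X → ∀ i → X ≡ r i [mod ms i ]
crt {zero}  ms pw r = 0 , λ ()
crt {suc d} ms pw r =
  let X′ , X′≡r = crt (tail ms) (Pairwise-coprime-tail pw) (tail r)
      X , X≡r₀ , X≡X′ = crt₂ (coprime-head-prodF pw) (r zero) X′
  in X , λ { zero → X≡r₀ ; (suc i) → ≡-mod-trans (≡-mod-∣ (∣prodF (tail ms) i) X≡X′) (X′≡r i) }
  where
  instance
    _ : NonZero (prodF d (tail ms))
    _ = prodF-nonZero (tail ms)

module _ (N k : ℕ) {m : ℕ} .{{_ : NonZero m}} where

  InL-intro : ∀ {z : Fin m} X Y → X * Y ≡ N [mod m ] → k * X + Y ≡ toℕ z [mod m ] → InL N m k z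
  InL-intro {z} X Y XY≡N kX+Y≡z =
    X mod m , Y mod m ,
    %≡% (≡-mod-trans (*-cong-mod (toℕ-mod-≡ X) (toℕ-mod-≡ Y)) XY≡N) ,
    trans (%≡% (≡-mod-trans (+-cong-mod (*-cong-mod (≡-mod-refl k) (toℕ-mod-≡ X)) (toℕ-mod-≡ Y)) kX+Y≡z))
          (toℕ%n z)

  InL-elim : ∀ {z : Fin m} → InL N m k z →
    ∃₂ λ X Y → X * Y ≡ N [mod m ] × k * X + Y ≡ toℕ z [mod m ]
  InL-elim {z} (x , y , xy≡N , kx+y≡z) =
    toℕ x , toℕ y , mk-≡-mod xy≡N , mk-≡-mod (trans kx+y≡z (sym (toℕ%n z)))

InL-reduce : ∀ N k {m m′} .{{_ : NonZero m}} .{{_ : NonZero m′}} → m′ ∣ m →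
  (z : Fin m) → InL N m k z → InL N m′ k (reduce m′ z)
InL-reduce N k m′∣m z l =
  let X , Y , XY≡N , kX+Y≡z = InL-elim N k l
  in InL-intro N k X Y (≡-mod-∣ m′∣m XY≡N)
       (≡-mod-trans (≡-mod-∣ m′∣m kX+Y≡z) (≡-mod-sym (toℕ-mod-≡ (toℕ z))))

module _ {d : ℕ} {ms : Fin d → ℕ} {{nz : ∀ {i} → NonZero (ms i)}} .{{_ : NonZero (prodF d ms)}}
         (pw : Pairwise-coprime ms) where

  reduce-injective : (x x′ : Fin (prodF d ms)) → (∀ i → reduce (ms i) x ≡ reduce (ms i) x′) → x ≡ x′
  reduce-injective x x′ x≡x′ =
    trans (sym (≡-mod⇒mod-≡ (≡-mod-refl (toℕ x))))
          (≡-mod⇒mod-≡ (≡-mod-prodF pw (toℕ x) (toℕ x′) (mod-≡⇒≡-mod ∘ x≡x′)))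

  InL-lift : ∀ N k (z : ∀ i → Fin (ms i)) → (∀ i → InL N (ms i) k (z i)) →
    Σ (Fin (prodF d ms)) λ x → InL N (prodF d ms) k x × (∀ i → reduce (ms i) x ≡ z i)
  InL-lift N k z l =
    (k * X + Y) mod prodF d ms , InL-intro N k X Y XY≡N (≡-mod-sym (toℕ-mod-≡ _)) , reduces
    where
    xs ys : ∀ i → ℕ
    xs i = proj₁ (InL-elim N k (l i))
    ys i = proj₁ (proj₂ (InL-elim N k (l i)))
    xy≡N : ∀ i → xs i * ys i ≡ N [mod ms i ]
    xy≡N i = proj₁ (proj₂ (proj₂ (InL-elim N k (l i))))
    kx+y≡z : ∀ i → k * xs i + ys i ≡ toℕ (z i) [mod ms i ]
    kx+y≡z i = proj₂ (proj₂ (proj₂ (InL-elim N k (l i))))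
    X = proj₁ (crt ms pw xs)
    Y = proj₁ (crt ms pw ys)
    X≡xs : ∀ i → X ≡ xs i [mod ms i ]
    X≡xs = proj₂ (crt ms pw xs)
    Y≡ys : ∀ i → Y ≡ ys i [mod ms i ]
    Y≡ys = proj₂ (crt ms pw ys)
    XY≡N : X * Y ≡ N [mod prodF d ms ]
    XY≡N = ≡-mod-prodF pw _ _ λ i → ≡-mod-trans (*-cong-mod (X≡xs i) (Y≡ys i)) (xy≡N i)
    reduces : ∀ i → reduce (ms i) ((k * X + Y) mod prodF d ms) ≡ z i
    reduces i = ≡-mod⇒mod-≡ (≡-mod-trans (≡-mod-∣ (∣prodF ms i) (toℕ-mod-≡ (k * X + Y)))
      (≡-mod-trans (+-cong-mod (*-cong-mod (≡-mod-refl k) (X≡xs i)) (Y≡ys i)) (kx+y≡z i)))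

lemma3p6 : (N k d : ℕ) (ms : Fin d → ℕ) (nz : (i : Fin d) → NonZero (ms i))
    → .{{_ : NonZero (prodF d ms)}}
    → ((i j : Fin d) → i ≢ j → Coprime (ms i) (ms j))
    → Coprime (N * k) (prodF d ms)
    → (((x : Fin (prodF d ms)) → InL N (prodF d ms) k x
          → (i : Fin d) → InL N (ms i) k {{nz i}} (reduce (ms i) {{nz i}} x))
      × ((x x′ : Fin (prodF d ms)) → InL N (prodF d ms) k x → InL N (prodF d ms) k x′
          → ((i : Fin d) → reduce (ms i) {{nz i}} x ≡ reduce (ms i) {{nz i}} x′)
          → x ≡ x′)
      × ((z : (i : Fin d) → Fin (ms i)) → ((i : Fin d) → InL N (ms i) k {{nz i}} (z i))
          → Σ (Fin (prodF d ms)) λ x → InL N (prodF d ms) k x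
              × ((i : Fin d) → reduce (ms i) {{nz i}} x ≡ z i)))
      × ((x : Fin (prodF d ms)) → ((i : Fin d) → InL N (ms i) k {{nz i}} (reduce (ms i) {{nz i}} x))
          → InL N (prodF d ms) k x)
lemma3p6 N k d ms nz pw _ =
  ( (λ x l i → InL-reduce N k (∣prodF ms i) x l)
  , (λ x x′ _ _ → reduce-injective pw x x′)
  , InL-lift pw N k )
  , λ x l →
      let x′ , l′ , x′↦x = InL-lift pw N k _ l
      in subst (InL N (prodF d ms) k) (reduce-injective pw x′ x x′↦x) l′
  where
  instance
    _ : ∀ {i} → NonZero (ms i)
    _ = nz _
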